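{- Let $\mathcal X,\mathcal Y\subseteq\mathcal M$, $i\in\mathbb N$ and $r\in\{\beta,\beta\eta,h\}$. (1) $(\mathcal X\cap\mathcal Y)^{+i}=\mathcal X^{+i}\cap\mathcal Y^{+i}$. (2) If $\mathcal X,\mathcal Y$ are $r$-saturated then $\mathcal X\cap\mathcal Y$ is $r$-saturated. (3) If $\mathcal X$ is $r$-saturated then $\mathcal X^{+i}$ is $r$-saturated. (4) If $\mathcal Y$ is $r$-saturated then for every set $\mathcal X$, $\mathcal X\leadsto\mathcal Y$ is $r$-saturated. (5) $(\mathcal X\leadsto\mathcal Y)^{+i}\subseteq\mathcal X^{+i}\leadsto\mathcal Y^{+i}$. (6) If $\mathcal X^{+i}\wr\mathcal Y^{+i}$, then $\mathcal X^{+i}\leadsto\mathcal Y^{+i}\subseteq(\mathcal X\leadsto\mathcal Y)^{+i}$.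
   Context: Indexes: finite sequences of natural numbers ($\mathcal L_{\mathbb N}$), $\oslash$ empty, $i::L$ prepending $i$, $L_1\preceq L_2$ iff $L_2=L_1::L_3$ for some $L_3$ (concatenation). Terms: over a countably infinite set $\mathcal V$, terms $\mathcal M$, free indexed variables $\mathrm{fv}$, degree $d$, joinability $\diamond$ defined simultaneously: $x^L\in\mathcal M$ ($\mathrm{fv}=\{x^L\}$, $d=L$); $MN\in\mathcal M$ when $d(M)\preceq d(N)$, $M\diamond N$ ($\mathrm{fv}$ union, $d(MN)=d(M)$); $\lambda x^L.M\in\mathcal M$ when $L\succeq d(M)$ ($\mathrm{fv}(M)\setminus\{x^L\}$, $d=d(M)$). $M\diamond N$ iff $x^L\in\mathrm{fv}(M)$, $x^K\in\mathrm{fv}(N)$ imply $L=K$. Terms modulo $\alpha$; $M[x^L:=N]$ defined only if $M\diamond N$, $d(N)=L$. $\rhd_\beta$: least relation compatible with abstraction and application containing $(\lambda x^L.M)N\rhd_\beta M[x^L:=N]$ ($d(N)=L$); $\rhd_\eta$: from $\lambda x^L.(Mx^L)\rhd_\eta M$ ($x^L\notin\mathrm{fv}(M)$); $\rhd_{\beta\eta}=\rhd_\beta\cup\rhd_\eta$; $(\lambda x^L.M)NN_1\dots N_n\rhd_hM[x^L:=N]N_1\dots N_n$; $\rhd^*_r$ reflexive–transitive closure. Lifting $(x^L)^{+i}=x^{i::L}$, $(M_1M_2)^{+i}=M_1^{+i}M_2^{+i}$, $(\lambda x^L.M)^{+i}=\lambda x^{i::L}.M^{+i}$. Sets of terms: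 $\mathcal X^{+i}=\{M^{+i}:M\in\mathcal X\}$; $\mathcal X\leadsto\mathcal Y=\{M\in\mathcal M: MN\in\mathcal Y$ for all $N\in\mathcal X$ with $M\diamond N\}$; $\mathcal X\wr\mathcal Y$ iff for every $M\in\mathcal X\leadsto\mathcal Y$ there exists $N\in\mathcal X$ with $M\diamond N$; $\mathcal X$ is $r$-saturated if whenever $M\rhd^*_rN$ and $N\in\mathcal X$ then $M\in\mathcal X$. -}

module Defs where

open import Level using (Level)
open import Data.Nat using (ℕ; zero; suc; _<_; pred)
open import Data.Nat.Properties using (<-cmp; _<?_)
open import Data.List using (List; []; _∷_; _++_; length)
open import Data.Product using (Σ; _×_; _,_)
open import Data.Sum using (_⊎_)
open import Relation.Binary.PropositionalEquality using (_≡_)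
open import Relation.Binary.Definitions using (tri<; tri≈; tri>)
open import Relation.Binary.Construct.Closure.ReflexiveTransitive using (Star)
open import Relation.Nullary using (yes; no)
open import Relation.Unary using (Pred)

Idx : Set
Idx = List ℕ

infix 4 _⪯_
_⪯_ : Idx → Idx → Set
L₁ ⪯ L₂ = Σ Idx (λ L₃ → L₂ ≡ L₁ ++ L₃)

-- Raw terms, locally nameless: free indexed variables x^L are atoms
-- (x ∈ 𝒱 = ℕ), bound variables are de Bruijn indices, and a binder
-- λx^L records only the index L. Hence α-equivalent terms are
-- syntactically equal (terms modulo α).

Name : Set
Name = ℕ

data Tm : Set where
  fvar : Name → Idx → Tm
  bvar : ℕ → Tm
  app  : Tm → Tm → Tm
  lam  : Idx → Tm → Tm

data FV : Tm → Name → Idx → Set where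
  fv-var  : ∀ {x L} → FV (fvar x L) x L
  fv-appl : ∀ {M N x L} → FV M x L → FV (app M N) x L
  fv-appr : ∀ {M N x L} → FV N x L → FV (app M N) x L
  fv-lam  : ∀ {K M x L} → FV M x L → FV (lam K M) x L

infix 4 _⋄_
_⋄_ : Tm → Tm → Set
M ⋄ N = ∀ {x L K} → FV M x L → FV N x K → L ≡ K

-- degree, relative to a context Γ of indices of the enclosing binders
lookupD : List Idx → ℕ → Idx
lookupD []      n       = []
lookupD (L ∷ Γ) zero    = L
lookupD (L ∷ Γ) (suc n) = lookupD Γ n

degΓ : List Idx → Tm → Idx
degΓ Γ (fvar x L) = L
degΓ Γ (bvar n)   = lookupD Γ n
degΓ Γ (app M N)  = degΓ Γ M
degΓ Γ (lam L M)  = degΓ (L ∷ Γ) M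

d : Tm → Idx
d = degΓ []

data WF (Γ : List Idx) : Tm → Set where
  wf-fvar : ∀ {x L} → WF Γ (fvar x L)
  wf-bvar : ∀ {n} → n < length Γ → WF Γ (bvar n)
  wf-app  : ∀ {M N} → WF Γ M → WF Γ N → degΓ Γ M ⪯ degΓ Γ N → M ⋄ N →
            WF Γ (app M N)
  wf-lam  : ∀ {L M} → WF (L ∷ Γ) M → degΓ (L ∷ Γ) M ⪯ L → WF Γ (lam L M)

𝓜 : Pred Tm _
𝓜 M = WF [] M

shift : ℕ → Tm → Tm
shift c (fvar x L) = fvar x L
shift c (bvar n) with n <? c
... | yes _ = bvar n
... | no  _ = bvar (suc n)
shift c (app M N) = app (shift c M) (shift c N)
shift c (lam L M) = lam L (shift (suc c) M)

sub : ℕ → Tm → Tm → Tm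
sub k N (fvar x L) = fvar x L
sub k N (bvar n) with <-cmp n k
... | tri< _ _ _ = bvar n
... | tri≈ _ _ _ = N
... | tri> _ _ _ = bvar (pred n)
sub k N (app M P) = app (sub k N M) (sub k N P)
sub k N (lam L M) = lam L (sub (suc k) (shift 0 N) M)

data Stepβ (Γ : List Idx) : Tm → Tm → Set where
  β-redex : ∀ {L M N} → lam L M ⋄ N → degΓ Γ N ≡ L →
            Stepβ Γ (app (lam L M) N) (sub 0 N M)
  β-appl  : ∀ {M M' N} → Stepβ Γ M M' → Stepβ Γ (app M N) (app M' N)
  β-appr  : ∀ {M N N'} → Stepβ Γ N N' → Stepβ Γ (app M N) (app M N')
  β-lam   : ∀ {L M M'} → Stepβ (L ∷ Γ) M M' → Stepβ Γ (lam L M) (lam L M')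

-- η: compatible closure of λx^L.(M x^L) ▷ M  (x^L ∉ fv(M), i.e. the
-- body is the shift of M applied to the bound variable)
data Stepη : Tm → Tm → Set where
  η-redex : ∀ {L M} → Stepη (lam L (app (shift 0 M) (bvar 0))) M
  η-appl  : ∀ {M M' N} → Stepη M M' → Stepη (app M N) (app M' N)
  η-appr  : ∀ {M N N'} → Stepη N N' → Stepη (app M N) (app M N')
  η-lam   : ∀ {L M M'} → Stepη M M' → Stepη (lam L M) (lam L M')

data Steph : Tm → Tm → Set where
  h-redex : ∀ {L M N} → lam L M ⋄ N → d N ≡ L →
            Steph (app (lam L M) N) (sub 0 N M)
  h-appl  : ∀ {M M' N} → Steph M M' → Steph (app M N) (app M' N)

data Red : Set where
  β βη h : Red

Step : Red → Tm → Tm → Set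
Step β  M N = Stepβ [] M N
Step βη M N = Stepβ [] M N ⊎ Stepη M N
Step h  M N = Steph M N

_▷*[_]_ : Tm → Red → Tm → Set
M ▷*[ r ] N = Star (Step r) M N

lift : ℕ → Tm → Tm
lift i (fvar x L) = fvar x (i ∷ L)
lift i (bvar n)   = bvar n
lift i (app M N)  = app (lift i M) (lift i N)
lift i (lam L M)  = lam (i ∷ L) (lift i M)

module _ {ℓ : Level} where

  infixl 9 _⁺_
  infixr 7 _⤳_
  infix 5 _≀_

  _⁺_ : Pred Tm ℓ → ℕ → Pred Tm ℓ
  (X ⁺ i) M = Σ Tm (λ N → X N × lift i N ≡ M)

  _⤳_ : Pred Tm ℓ → Pred Tm ℓ → Pred Tm ℓ
  (X ⤳ Y) M = 𝓜 M × (∀ N → X N → M ⋄ N → Y (app M N))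

  _≀_ : Pred Tm ℓ → Pred Tm ℓ → Set ℓ
  X ≀ Y = ∀ M → (X ⤳ Y) M → Σ Tm (λ N → X N × M ⋄ N)

  -- r-saturation (the reduction relations are relations on 𝓜, so the
  -- source term M is required to be a term)
  Saturated : Red → Pred Tm ℓ → Set ℓ
  Saturated r X = ∀ {M N} → 𝓜 M → M ▷*[ r ] N → X N → X M

-- Lifting prepends i to every index. It has a left inverse `unlift`,
-- which drops the head of every index, so lifting is injective and preserves
-- and reflects joinability. Conversely, a well-formed term whose degree starts
-- with i is the lift of its unlift, because the degree of a subterm always
-- extends the degree of the whole term.
--
-- For the reductions we prove three facts about a single step, then extend
-- them to ▷*_r with the folds of the reflexive-transitive closure: a step
-- preserves the degree, it creates no free variables, and it commutes with
-- unlift. (Head steps are β-steps at top level, so the first two facts only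
-- need to be proved for β and η.)
--
-- Facts about terms are stated for an arbitrary context Γ of enclosing
-- binders (𝓜 is the case Γ = []), since the inductions go under λ.

module Submission where

open import Defs
open import Level using (Level)
open import Data.Nat using (ℕ; zero; suc; _<_; _≤_; s≤s)
open import Data.Nat.Properties using (<-cmp; _<?_; ≮⇒≥)
open import Data.List using (List; []; _∷_; _++_; map; length)
open import Data.List.Properties using (length-map)
open import Data.Product using (Σ; ∃₂; _×_; _,_)
open import Data.Sum using (_⊎_; inj₁; inj₂)
open import Relation.Binary.PropositionalEquality
  using (_≡_; refl; sym; trans; cong; cong₂; subst; subst₂)
open import Relation.Binary.Definitions using (tri<; tri≈; tri>)
open import Relation.Binary.Construct.Closure.ReflexiveTransitive using (gmap; fold)
open import Relation.Nullary using (yes; no)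
open import Relation.Unary using (Pred; _⊆_; _∩_; _≐_)

behead : Idx → Idx
behead []      = []
behead (_ ∷ L) = L

unlift : Tm → Tm
unlift (fvar x L) = fvar x (behead L)
unlift (bvar n)   = bvar n
unlift (app M N)  = app (unlift M) (unlift N)
unlift (lam L M)  = lam (behead L) (unlift M)

unlift-lift : ∀ i M → unlift (lift i M) ≡ M
unlift-lift i (fvar x L) = refl
unlift-lift i (bvar n)   = refl
unlift-lift i (app M N)  = cong₂ app (unlift-lift i M) (unlift-lift i N)
unlift-lift i (lam L M)  = cong (lam L) (unlift-lift i M)

-- a function with a left inverse is injective
lift-injective : ∀ i {M N} → lift i M ≡ lift i N → M ≡ N
lift-injective i {M} {N} e =
  trans (sym (unlift-lift i M)) (trans (cong unlift e) (unlift-lift i N))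

lift-app-inv : ∀ i P {M N} → lift i P ≡ app M N →
               ∃₂ λ P₁ P₂ → P ≡ app P₁ P₂ × lift i P₁ ≡ M
lift-app-inv i (app P₁ P₂) refl = P₁ , P₂ , refl , refl
lift-app-inv i (fvar _ _)  ()
lift-app-inv i (bvar _)    ()
lift-app-inv i (lam _ _)   ()

FV-lift : ∀ i M {x L} → FV M x L → FV (lift i M) x (i ∷ L)
FV-lift i (fvar x L) fv-var     = fv-var
FV-lift i (app M N)  (fv-appl p) = fv-appl (FV-lift i M p)
FV-lift i (app M N)  (fv-appr p) = fv-appr (FV-lift i N p)
FV-lift i (lam K M)  (fv-lam p)  = fv-lam (FV-lift i M p)

FV-lift⁻ : ∀ i M {x L} → FV (lift i M) x L → Σ Idx λ K → FV M x K × L ≡ i ∷ K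
FV-lift⁻ i (fvar x L) fv-var = L , fv-var , refl
FV-lift⁻ i (app M N) (fv-appl p) with FV-lift⁻ i M p
... | K , q , e = K , fv-appl q , e
FV-lift⁻ i (app M N) (fv-appr p) with FV-lift⁻ i N p
... | K , q , e = K , fv-appr q , e
FV-lift⁻ i (lam K M) (fv-lam p) with FV-lift⁻ i M p
... | K' , q , e = K' , fv-lam q , e

FV-unlift : ∀ M {x L} → FV (unlift M) x L → Σ Idx λ K → FV M x K × behead K ≡ L
FV-unlift (fvar x L) fv-var = L , fv-var , refl
FV-unlift (app M N) (fv-appl p) with FV-unlift M p
... | K , q , e = K , fv-appl q , e
FV-unlift (app M N) (fv-appr p) with FV-unlift N p
... | K , q , e = K , fv-appr q , e
FV-unlift (lam K M) (fv-lam p) with FV-unlift M p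
... | K' , q , e = K' , fv-lam q , e

⋄-lift : ∀ i M N → M ⋄ N → lift i M ⋄ lift i N
⋄-lift i M N j p q with FV-lift⁻ i M p | FV-lift⁻ i N q
... | _ , p' , refl | _ , q' , refl = cong (i ∷_) (j p' q')

⋄-lift⁻ : ∀ i M N → lift i M ⋄ lift i N → M ⋄ N
⋄-lift⁻ i M N j p q = cong behead (j (FV-lift i M p) (FV-lift i N q))

⋄-unlift : ∀ M N → M ⋄ N → unlift M ⋄ unlift N
⋄-unlift M N j p q with FV-unlift M p | FV-unlift N q
... | _ , p' , refl | _ , q' , refl = cong behead (j p' q')

lookupD-map : ∀ (f : Idx → Idx) Γ n → n < length Γ →
              lookupD (map f Γ) n ≡ f (lookupD Γ n)
lookupD-map f (L ∷ Γ) zero    _       = refl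
lookupD-map f (L ∷ Γ) (suc n) (s≤s p) = lookupD-map f Γ n p

-- behead [] = [] matches the default of lookupD, so no bound is needed here
lookupD-behead : ∀ Γ n → lookupD (map behead Γ) n ≡ behead (lookupD Γ n)
lookupD-behead []      n       = refl
lookupD-behead (L ∷ Γ) zero    = refl
lookupD-behead (L ∷ Γ) (suc n) = lookupD-behead Γ n

deg-lift : ∀ i Γ M → WF Γ M → degΓ (map (i ∷_) Γ) (lift i M) ≡ i ∷ degΓ Γ M
deg-lift i Γ (fvar x L) _                = refl
deg-lift i Γ (bvar n)   (wf-bvar p)      = lookupD-map (i ∷_) Γ n p
deg-lift i Γ (app M N)  (wf-app w _ _ _) = deg-lift i Γ M w
deg-lift i Γ (lam L M)  (wf-lam w _)     = deg-lift i (L ∷ Γ) M w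

deg-unlift : ∀ Γ M → degΓ (map behead Γ) (unlift M) ≡ behead (degΓ Γ M)
deg-unlift Γ (fvar x L) = refl
deg-unlift Γ (bvar n)   = lookupD-behead Γ n
deg-unlift Γ (app M N)  = deg-unlift Γ M
deg-unlift Γ (lam L M)  = deg-unlift (L ∷ Γ) M

⪯-cons : ∀ i {L K} → L ⪯ K → (i ∷ L) ⪯ (i ∷ K)
⪯-cons i (L₃ , e) = L₃ , cong (i ∷_) e

⪯-behead : ∀ {L K} → L ⪯ K → behead L ⪯ behead K
⪯-behead {[]}    {K} _          = behead K , refl
⪯-behead {a ∷ L}     (L₃ , refl) = L₃ , refl

WF-lift : ∀ i Γ M → WF Γ M → WF (map (i ∷_) Γ) (lift i M)
WF-lift i Γ (fvar x L) _ = wf-fvar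
WF-lift i Γ (bvar n) (wf-bvar p) =
  wf-bvar (subst (n <_) (sym (length-map (i ∷_) Γ)) p)
WF-lift i Γ (app M N) (wf-app w v le j) =
  wf-app (WF-lift i Γ M w) (WF-lift i Γ N v)
    (subst₂ _⪯_ (sym (deg-lift i Γ M w)) (sym (deg-lift i Γ N v)) (⪯-cons i le))
    (⋄-lift i M N j)
WF-lift i Γ (lam L M) (wf-lam w le) =
  wf-lam (WF-lift i (L ∷ Γ) M w)
    (subst (_⪯ (i ∷ L)) (sym (deg-lift i (L ∷ Γ) M w)) (⪯-cons i le))

WF-unlift : ∀ Γ M → WF Γ M → WF (map behead Γ) (unlift M)
WF-unlift Γ (fvar x L) _ = wf-fvar
WF-unlift Γ (bvar n) (wf-bvar p) =
  wf-bvar (subst (n <_) (sym (length-map behead Γ)) p)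
WF-unlift Γ (app M N) (wf-app w v le j) =
  wf-app (WF-unlift Γ M w) (WF-unlift Γ N v)
    (subst₂ _⪯_ (sym (deg-unlift Γ M)) (sym (deg-unlift Γ N)) (⪯-behead le))
    (⋄-unlift M N j)
WF-unlift Γ (lam L M) (wf-lam w le) =
  wf-lam (WF-unlift (L ∷ Γ) M w)
    (subst (_⪯ behead L) (sym (deg-unlift (L ∷ Γ) M)) (⪯-behead le))

app-WF-function : ∀ {Γ M N} → WF Γ (app M N) → WF Γ M
app-WF-function (wf-app w _ _ _) = w

app-WF-degree : ∀ {Γ M N} → WF Γ (app M N) → degΓ Γ M ⪯ degΓ Γ N
app-WF-degree (wf-app _ _ le _) = le

HeadIs : ℕ → Idx → Set
HeadIs i L = Σ Idx λ K → L ≡ i ∷ K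

HeadIs-⪯ : ∀ {i L K} → HeadIs i L → L ⪯ K → HeadIs i K
HeadIs-⪯ (K₀ , refl) (L₃ , refl) = K₀ ++ L₃ , refl

-- In a well-formed term all indices (of free variables and binders) extend
-- its degree; so if the degree starts with i, the term is a lift by i.
lift-unlift : ∀ i Γ M → WF Γ M → HeadIs i (degΓ Γ M) → lift i (unlift M) ≡ M
lift-unlift i Γ (fvar x .(i ∷ K)) _ (K , refl) = refl
lift-unlift i Γ (bvar n) _ _ = refl
lift-unlift i Γ (app M N) (wf-app w v le _) s =
  cong₂ app (lift-unlift i Γ M w s) (lift-unlift i Γ N v (HeadIs-⪯ s le))
lift-unlift i Γ (lam L M) (wf-lam w le) s with HeadIs-⪯ s le
... | K , refl = cong (lam L) (lift-unlift i (L ∷ Γ) M w s)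

FV-shift : ∀ c M {x L} → FV (shift c M) x L → FV M x L
FV-shift c (fvar x L) fv-var = fv-var
FV-shift c (bvar n) with n <? c
... | yes _ = λ ()
... | no  _ = λ ()
FV-shift c (app M N) (fv-appl p) = fv-appl (FV-shift c M p)
FV-shift c (app M N) (fv-appr p) = fv-appr (FV-shift c N p)
FV-shift c (lam K M) (fv-lam p)  = fv-lam (FV-shift (suc c) M p)

FV-shift⁺ : ∀ c M {x L} → FV M x L → FV (shift c M) x L
FV-shift⁺ c (fvar x L) fv-var     = fv-var
FV-shift⁺ c (app M N)  (fv-appl p) = fv-appl (FV-shift⁺ c M p)
FV-shift⁺ c (app M N)  (fv-appr p) = fv-appr (FV-shift⁺ c N p)
FV-shift⁺ c (lam K M)  (fv-lam p)  = fv-lam (FV-shift⁺ (suc c) M p)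

FV-sub : ∀ k N M {x L} → FV (sub k N M) x L → FV M x L ⊎ FV N x L
FV-sub k N (fvar x L) fv-var = inj₁ fv-var
FV-sub k N (bvar n) with <-cmp n k
... | tri< _ _ _ = λ ()
... | tri≈ _ _ _ = inj₂
... | tri> _ _ _ = λ ()
FV-sub k N (app M P) (fv-appl p) with FV-sub k N M p
... | inj₁ q = inj₁ (fv-appl q)
... | inj₂ q = inj₂ q
FV-sub k N (app M P) (fv-appr p) with FV-sub k N P p
... | inj₁ q = inj₁ (fv-appr q)
... | inj₂ q = inj₂ q
FV-sub k N (lam K M) (fv-lam p) with FV-sub (suc k) (shift 0 N) M p
... | inj₁ q = inj₁ (fv-lam q)
... | inj₂ q = inj₂ (FV-shift 0 N q)

-- insertD c K Γ: the context Γ with K inserted at position c (padded with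
-- the default index [] of lookupD), i.e. the context seen by the body of a
-- binder of index K that sits c binders deep
insertD : ℕ → Idx → List Idx → List Idx
insertD zero    K Γ       = K ∷ Γ
insertD (suc c) K []      = [] ∷ insertD c K []
insertD (suc c) K (L ∷ Γ) = L ∷ insertD c K Γ

lookupD-insert-< : ∀ c K Γ n → n < c → lookupD (insertD c K Γ) n ≡ lookupD Γ n
lookupD-insert-< (suc c) K []      zero    _       = refl
lookupD-insert-< (suc c) K []      (suc n) (s≤s p) = lookupD-insert-< c K [] n p
lookupD-insert-< (suc c) K (L ∷ Γ) zero    _       = refl
lookupD-insert-< (suc c) K (L ∷ Γ) (suc n) (s≤s p) = lookupD-insert-< c K Γ n p

lookupD-insert-≥ : ∀ c K Γ n → c ≤ n →
                   lookupD (insertD c K Γ) (suc n) ≡ lookupD Γ n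
lookupD-insert-≥ zero    K Γ       n       _       = refl
lookupD-insert-≥ (suc c) K []      (suc n) (s≤s p) = lookupD-insert-≥ c K [] n p
lookupD-insert-≥ (suc c) K (L ∷ Γ) (suc n) (s≤s p) = lookupD-insert-≥ c K Γ n p

lookupD-insert-≡ : ∀ c K Γ → lookupD (insertD c K Γ) c ≡ K
lookupD-insert-≡ zero    K Γ       = refl
lookupD-insert-≡ (suc c) K []      = lookupD-insert-≡ c K []
lookupD-insert-≡ (suc c) K (L ∷ Γ) = lookupD-insert-≡ c K Γ

-- shifting at c is weakening: it does not change the degree
deg-shift : ∀ c K Γ M → degΓ (insertD c K Γ) (shift c M) ≡ degΓ Γ M
deg-shift c K Γ (fvar x L) = refl
deg-shift c K Γ (bvar n) with n <? c
... | yes p = lookupD-insert-< c K Γ n p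
... | no  p = lookupD-insert-≥ c K Γ n (≮⇒≥ p)
deg-shift c K Γ (app M N) = deg-shift c K Γ M
deg-shift c K Γ (lam L M) = deg-shift (suc c) K (L ∷ Γ) M

deg-sub : ∀ k K Γ N M → degΓ Γ N ≡ K →
          degΓ (insertD k K Γ) M ≡ degΓ Γ (sub k N M)
deg-sub k K Γ N (fvar x L) e = refl
deg-sub k K Γ N (bvar n) e with <-cmp n k
... | tri< n<k _ _ = lookupD-insert-< k K Γ n n<k
... | tri≈ _ refl _ = trans (lookupD-insert-≡ k K Γ) (sym e)
deg-sub k K Γ N (bvar (suc n)) e | tri> _ _ (s≤s k≤n) = lookupD-insert-≥ k K Γ n k≤n
deg-sub k K Γ N (app M P) e = deg-sub k K Γ N M e
deg-sub k K Γ N (lam L M) e =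
  deg-sub (suc k) K (L ∷ Γ) (shift 0 N) M (trans (deg-shift 0 L Γ N) e)

unlift-shift : ∀ c M → unlift (shift c M) ≡ shift c (unlift M)
unlift-shift c (fvar x L) = refl
unlift-shift c (bvar n) with n <? c
... | yes _ = refl
... | no  _ = refl
unlift-shift c (app M N) = cong₂ app (unlift-shift c M) (unlift-shift c N)
unlift-shift c (lam L M) = cong (lam (behead L)) (unlift-shift (suc c) M)

unlift-sub : ∀ k N M → unlift (sub k N M) ≡ sub k (unlift N) (unlift M)
unlift-sub k N (fvar x L) = refl
unlift-sub k N (bvar n) with <-cmp n k
... | tri< _ _ _ = refl
... | tri≈ _ _ _ = refl
... | tri> _ _ _ = refl
unlift-sub k N (app M P) = cong₂ app (unlift-sub k N M) (unlift-sub k N P)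
unlift-sub k N (lam L M) =
  cong (lam (behead L))
    (trans (unlift-sub (suc k) (shift 0 N) M)
           (cong (λ t → sub (suc k) t (unlift M)) (unlift-shift 0 N)))

h⇒β : ∀ {M N} → Steph M N → Stepβ [] M N
h⇒β (h-redex j e) = β-redex j e
h⇒β (h-appl s)    = β-appl (h⇒β s)

step⇒βη : ∀ r {M N} → Step r M N → Stepβ [] M N ⊎ Stepη M N
step⇒βη β  s = inj₁ s
step⇒βη βη s = s
step⇒βη h  s = inj₁ (h⇒β s)

degβ : ∀ {Γ M N} → Stepβ Γ M N → degΓ Γ M ≡ degΓ Γ N
degβ {Γ} (β-redex {L} {M} {N} _ e) = deg-sub 0 L Γ N M e
degβ (β-appl s) = degβ s
degβ (β-appr s) = refl
degβ (β-lam s)  = degβ s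

degη : ∀ {M N} → Stepη M N → ∀ Γ → degΓ Γ M ≡ degΓ Γ N
degη (η-redex {L} {M}) Γ = deg-shift 0 L Γ M
degη (η-appl s)        Γ = degη s Γ
degη (η-appr s)        Γ = refl
degη (η-lam {L} s)     Γ = degη s (L ∷ Γ)

FV-β : ∀ {Γ M N x L} → Stepβ Γ M N → FV N x L → FV M x L
FV-β (β-redex {M = M} {N} _ _) p with FV-sub 0 N M p
... | inj₁ q = fv-appl (fv-lam q)
... | inj₂ q = fv-appr q
FV-β (β-appl s) (fv-appl p) = fv-appl (FV-β s p)
FV-β (β-appl s) (fv-appr p) = fv-appr p
FV-β (β-appr s) (fv-appl p) = fv-appl p
FV-β (β-appr s) (fv-appr p) = fv-appr (FV-β s p)
FV-β (β-lam s)  (fv-lam p)  = fv-lam (FV-β s p)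

FV-η : ∀ {M N x L} → Stepη M N → FV N x L → FV M x L
FV-η (η-redex {M = M}) p     = fv-lam (fv-appl (FV-shift⁺ 0 M p))
FV-η (η-appl s) (fv-appl p) = fv-appl (FV-η s p)
FV-η (η-appl s) (fv-appr p) = fv-appr p
FV-η (η-appr s) (fv-appl p) = fv-appl p
FV-η (η-appr s) (fv-appr p) = fv-appr (FV-η s p)
FV-η (η-lam s)  (fv-lam p)  = fv-lam (FV-η s p)

degStep : ∀ r {M N} → Step r M N → d M ≡ d N
degStep r s with step⇒βη r s
... | inj₁ sβ = degβ sβ
... | inj₂ sη = degη sη []

FV-step : ∀ r {M N x L} → Step r M N → FV N x L → FV M x L
FV-step r s with step⇒βη r s
... | inj₁ sβ = FV-β sβ
... | inj₂ sη = FV-η sη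

-- unlift maps steps to steps of the same kind (the side conditions of a
-- redex, joinability and d(N) = L, survive by ⋄-unlift and deg-unlift)
unlift-β : ∀ {Γ M N} → Stepβ Γ M N → Stepβ (map behead Γ) (unlift M) (unlift N)
unlift-β {Γ} (β-redex {L} {M} {N} j e) =
  subst (Stepβ (map behead Γ) (app (lam (behead L) (unlift M)) (unlift N)))
        (sym (unlift-sub 0 N M))
        (β-redex (⋄-unlift (lam L M) N j) (trans (deg-unlift Γ N) (cong behead e)))
unlift-β (β-appl s) = β-appl (unlift-β s)
unlift-β (β-appr s) = β-appr (unlift-β s)
unlift-β (β-lam s)  = β-lam (unlift-β s)

unlift-η : ∀ {M N} → Stepη M N → Stepη (unlift M) (unlift N)
unlift-η (η-redex {L} {M}) =
  subst (λ t → Stepη (lam (behead L) (app t (bvar 0))) (unlift M))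
        (sym (unlift-shift 0 M)) η-redex
unlift-η (η-appl s) = η-appl (unlift-η s)
unlift-η (η-appr s) = η-appr (unlift-η s)
unlift-η (η-lam s)  = η-lam (unlift-η s)

unlift-h : ∀ {M N} → Steph M N → Steph (unlift M) (unlift N)
unlift-h (h-redex {L} {M} {N} j e) =
  subst (Steph (app (lam (behead L) (unlift M)) (unlift N)))
        (sym (unlift-sub 0 N M))
        (h-redex (⋄-unlift (lam L M) N j) (trans (deg-unlift [] N) (cong behead e)))
unlift-h (h-appl s) = h-appl (unlift-h s)

unlift-step : ∀ r {M N} → Step r M N → Step r (unlift M) (unlift N)
unlift-step β  s        = unlift-β s
unlift-step βη (inj₁ s) = inj₁ (unlift-β s)
unlift-step βη (inj₂ s) = inj₂ (unlift-η s)
unlift-step h  s        = unlift-h s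

appl-step : ∀ r {M M' N} → Step r M M' → Step r (app M N) (app M' N)
appl-step β  s        = β-appl s
appl-step βη (inj₁ s) = inj₁ (β-appl s)
appl-step βη (inj₂ s) = inj₂ (η-appl s)
appl-step h  s        = h-appl s

deg-▷* : ∀ r {M N} → M ▷*[ r ] N → d M ≡ d N
deg-▷* r = fold (λ M N → d M ≡ d N) (λ s e → trans (degStep r s) e) refl

⋄-▷* : ∀ r {M M' N} → M ▷*[ r ] M' → M ⋄ N → M' ⋄ N
⋄-▷* r red j p q = j (fold FVReflected (λ s f p → FV-step r s (f p)) (λ p → p) red p) q
  where
  FVReflected : Tm → Tm → Set
  FVReflected M M' = ∀ {x L} → FV M' x L → FV M x L

unlift-▷* : ∀ r {M N} → M ▷*[ r ] N → unlift M ▷*[ r ] unlift N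
unlift-▷* r = gmap unlift (unlift-step r)

appl-▷* : ∀ r {M M' N} → M ▷*[ r ] M' → app M N ▷*[ r ] app M' N
appl-▷* r {N = N} = gmap (λ M → app M N) (appl-step r)

module _ {ℓ : Level} where

  lift-∩ : ∀ (X Y : Pred Tm ℓ) i → (X ∩ Y) ⁺ i ≐ (X ⁺ i) ∩ (Y ⁺ i)
  lift-∩ X Y i = split , merge
    where
    split : (X ∩ Y) ⁺ i ⊆ (X ⁺ i) ∩ (Y ⁺ i)
    split (N , (xN , yN) , e) = (N , xN , e) , (N , yN , e)
    merge : (X ⁺ i) ∩ (Y ⁺ i) ⊆ (X ∩ Y) ⁺ i
    merge ((N , xN , e) , (N' , yN' , e')) =
      N , (xN , subst Y (lift-injective i (trans e' (sym e))) yN') , e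

  ∩-saturated : ∀ r {X Y : Pred Tm ℓ} →
                Saturated r X → Saturated r Y → Saturated r (X ∩ Y)
  ∩-saturated r sX sY w red (xN , yN) = sX w red xN , sY w red yN

  -- (3): if M ▷* lift i N₀ then d M = i ∷ d N₀, so M is the lift of unlift M,
  -- and unlift M ▷* unlift (lift i N₀) = N₀
  lift-saturated : ∀ r {X : Pred Tm ℓ} i → X ⊆ 𝓜 →
                   Saturated r X → Saturated r (X ⁺ i)
  lift-saturated r i X⊆𝓜 sX {M} w red (N₀ , xN₀ , refl) =
    unlift M , sX (WF-unlift [] M w) unlift-red xN₀ , lift-unlift i [] M w degM
    where
    unlift-red : unlift M ▷*[ r ] N₀
    unlift-red = subst (unlift M ▷*[ r ]_) (unlift-lift i N₀) (unlift-▷* r red)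
    degM : HeadIs i (d M)
    degM = d N₀ , trans (deg-▷* r red) (deg-lift i [] N₀ (X⊆𝓜 xN₀))

  -- (4): if M ▷* M' ∈ X ⤳ Y and N ∈ X is joinable with M, then N is joinable
  -- with M', so M' N ∈ Y; and M N ▷* M' N is an application of 𝓜 because
  -- d M = d M' ⪯ d N
  arrow-saturated : ∀ r {X Y : Pred Tm ℓ} → X ⊆ 𝓜 → Y ⊆ 𝓜 →
                    Saturated r Y → Saturated r (X ⤳ Y)
  arrow-saturated r {X} {Y} X⊆𝓜 Y⊆𝓜 sY {M} {M'} w red (_ , f) = w , apply
    where
    apply : ∀ N → X N → M ⋄ N → Y (app M N)
    apply N xN j = sY (wf-app w (X⊆𝓜 xN) dM⪯dN j) (appl-▷* r red) yM'N
      where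
      yM'N : Y (app M' N)
      yM'N = f N xN (⋄-▷* r red j)
      dM⪯dN : d M ⪯ d N
      dM⪯dN = subst (_⪯ d N) (sym (deg-▷* r red)) (app-WF-degree (Y⊆𝓜 yM'N))

  lift-arrow : ∀ (X Y : Pred Tm ℓ) i → (X ⤳ Y) ⁺ i ⊆ (X ⁺ i) ⤳ (Y ⁺ i)
  lift-arrow X Y i (M , (w , f) , refl) = WF-lift i [] M w , apply
    where
    apply : ∀ N → (X ⁺ i) N → lift i M ⋄ N → (Y ⁺ i) (app (lift i M) N)
    apply _ (N , xN , refl) j = app M N , f N xN (⋄-lift⁻ i M N j) , refl

  -- (6): a witness N ∈ X⁺ⁱ joinable with M shows M N ∈ Y⁺ⁱ, hence M is the
  -- lift of the function part M₀ of a term of Y (so M₀ ∈ 𝓜); M₀ ∈ X ⤳ Y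
  -- follows by injectivity of lifting
  arrow-lift : ∀ {X Y : Pred Tm ℓ} i → Y ⊆ 𝓜 →
               (X ⁺ i) ≀ (Y ⁺ i) → (X ⁺ i) ⤳ (Y ⁺ i) ⊆ (X ⤳ Y) ⁺ i
  arrow-lift {X} {Y} i Y⊆𝓜 joinable {M} (w , f) with joinable M (w , f)
  ... | N , xN , j with f N xN j
  ... | P , yP , e with lift-app-inv i P e
  ... | M₀ , _ , refl , refl = M₀ , (app-WF-function (Y⊆𝓜 yP) , apply) , refl
    where
    apply : ∀ N₀ → X N₀ → M₀ ⋄ N₀ → Y (app M₀ N₀)
    apply N₀ xN₀ j₀ with f (lift i N₀) (N₀ , xN₀ , refl) (⋄-lift i M₀ N₀ j₀)
    ... | Q , yQ , e' = subst Y (lift-injective i e') yQ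

lemma9 : ∀ {ℓ : Level} (X Y : Pred Tm ℓ) (i : ℕ) (r : Red) →
    X ⊆ 𝓜 → Y ⊆ 𝓜 →
    ((X ∩ Y) ⁺ i ≐ (X ⁺ i) ∩ (Y ⁺ i))
    × (Saturated r X → Saturated r Y → Saturated r (X ∩ Y))
    × (Saturated r X → Saturated r (X ⁺ i))
    × (Saturated r Y → Saturated r (X ⤳ Y))
    × ((X ⤳ Y) ⁺ i ⊆ (X ⁺ i) ⤳ (Y ⁺ i))
    × ((X ⁺ i) ≀ (Y ⁺ i) → (X ⁺ i) ⤳ (Y ⁺ i) ⊆ (X ⤳ Y) ⁺ i)
lemma9 X Y i r X⊆𝓜 Y⊆𝓜 =
    lift-∩ X Y i
  , ∩-saturated r
  , lift-saturated r i X⊆𝓜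
  , arrow-saturated r X⊆𝓜 Y⊆𝓜
  , lift-arrow X Y i
  , arrow-lift i Y⊆𝓜
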